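{- A precubical set $X$ can be embedded (by an injective precubical morphism) into a grid if and only if it can be sculpted, i.e. there exist $d$ and an injective precubical morphism $X\hookrightarrow B^d$ into the bulk $B^d$.
   Context: A precubical set is a family of disjoint sets $X_n$ with face maps $s_k,t_k:X_n\to X_{n-1}$ ($k=1,\dots,n$) satisfying $\alpha_k\beta_\ell=\beta_{\ell-1}\alpha_k$ for $\alpha,\beta\in\{s,t\}$, $k<\ell$; morphisms commute with face maps; $\dim X$ is the maximal dimension of a cell. The bulk $B^d$ has $n$-cells the tuples in $\{0,\ast,1\}^d$ with exactly $n$ entries $\ast$; $s_k$ (resp. $t_k$) replaces the $k$-th occurrence of $\ast$ by $0$ (resp. $1$). $X$ is non-selflinked if for all cells $q,q'$ there is at most one increasing index sequence $i_1<\dots<i_n$ with $q=\alpha^1_{i_1}\cdots\alpha^n_{i_n}q'$ for some $\alpha^j\in\{s,t\}$. A non-selflinked $X$ with $\dim X=d<\infty$ is a grid if there exist $M_1,\dots,M_d\in\mathbb N$ and a bijection $\Phi:\{1,\dots,M_1\}\times\cdots\times\{1,\dots,M_d\}\to X_d$ such that for all $k$ and all $(i_1,\dots,i_d)$ with $i_k\le M_k-1$, $t_k\Phi(i_1,\dots,i_d)=s_k\Phi(i_1,\dots,i_{k-1},i_k+1,i_{k+1},\dots,i_d)$, and there are no other face relations between cubes in $X$. -}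

module Defs where

open import Data.Nat using (ℕ; zero; suc; _≤_)
open import Data.Fin using (Fin; zero; suc; toℕ; inject₁)
open import Data.Bool using (Bool; true; false)
open import Data.Vec using (Vec; []; _∷_)
open import Data.Vec.Relation.Unary.All using (All)
open import Data.Product using (Σ; ∃; ∃-syntax; _×_; _,_)
open import Function.Definitions using (Injective)
open import Relation.Binary.PropositionalEquality using (_≡_)

-- Face side: false = s (source, replace by 0), true = t (target, replace by 1).
Side : Set
Side = Bool

-- Face indices are 0-based: the paper's s_k / t_k
-- (k = 1..n+1) on (n+1)-cells is  face false (k-1) / face true (k-1).
-- The cubical identity  α_k β_ℓ = β_{ℓ-1} α_k  for k < ℓ becomes, with
-- 0-based k and ℓ = suc l (so k ≤ l):
--   face α k (face β (suc l) x) ≡ face β l (face α (inject₁ k) x).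
record PreCubical : Set₁ where
  field
    Cell : ℕ → Set
    face : ∀ {n} → Side → Fin (suc n) → Cell (suc n) → Cell n
    cubical : ∀ {n} (α β : Side) (k l : Fin (suc n)) → toℕ k ≤ toℕ l →
              (x : Cell (suc (suc n))) →
              face α k (face β (suc l) x) ≡ face β l (face α (inject₁ k) x)

open PreCubical public

record Morphism (X Y : PreCubical) : Set where
  field
    map : ∀ n → Cell X n → Cell Y n
    commute : ∀ {n} (α : Side) (k : Fin (suc n)) (x : Cell X (suc n)) →
              map n (face X α k x) ≡ face Y α k (map (suc n) x)

open Morphism public

IsInjective : {X Y : PreCubical} → Morphism X Y → Set
IsInjective f = ∀ n → Injective _≡_ _≡_ (map f n)

_↪_ : PreCubical → PreCubical → Set
X ↪ Y = Σ (Morphism X Y) IsInjective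

_≅_ : PreCubical → PreCubical → Set
X ≅ Y = Σ (Morphism X Y) λ f → Σ (Morphism Y X) λ g →
          (∀ n x → map g n (map f n x) ≡ x) × (∀ n y → map f n (map g n y) ≡ y)

-- The bulk B^d.
-- BCell d n : tuples in {0,*,1}^d with exactly n entries *.
data BCell : ℕ → ℕ → Set where
  []  : BCell 0 0
  c0  : ∀ {d n} → BCell d n → BCell (suc d) n
  c1  : ∀ {d n} → BCell d n → BCell (suc d) n
  c*  : ∀ {d n} → BCell d n → BCell (suc d) (suc n)

sideVal : ∀ {d n} → Side → BCell d n → BCell (suc d) n
sideVal false = c0
sideVal true  = c1

bface : ∀ {d n} → Side → Fin (suc n) → BCell d (suc n) → BCell d n
bface α k       (c0 x) = c0 (bface α k x)
bface α k       (c1 x) = c1 (bface α k x)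
bface α zero    (c* x) = sideVal α x
bface {n = suc n} α (suc k) (c* x) = c* (bface α k x)

bface-cubical : ∀ {d n} (α β : Side) (k l : Fin (suc n)) → toℕ k ≤ toℕ l →
                (x : BCell d (suc (suc n))) →
                bface α k (bface β (suc l) x) ≡ bface β l (bface α (inject₁ k) x)
bface-cubical α β k l k≤l (c0 x) rewrite bface-cubical α β k l k≤l x = _≡_.refl
bface-cubical α β k l k≤l (c1 x) rewrite bface-cubical α β k l k≤l x = _≡_.refl
bface-cubical false β zero l k≤l (c* x) = _≡_.refl
bface-cubical true  β zero l k≤l (c* x) = _≡_.refl
bface-cubical {n = suc n} α β (suc k) (suc l) (Data.Nat.s≤s k≤l) (c* x)
  rewrite bface-cubical α β k l k≤l x = _≡_.refl

Bulk : ℕ → PreCubical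
Bulk d = record { Cell = BCell d ; face = bface ; cubical = bface-cubical }

-- The standard grid with M_1,...,M_d edges in the coordinate directions,
-- i.e. the cubical complex [0,M_1] × ... × [0,M_d].
-- GCell Ms n : tuples whose j-th entry is a vertex in {0..M_j} or an edge
-- in {1..M_j} (coded 0-based as Fin M_j; edge i runs from vertex i to i+1),
-- with exactly n edge entries.  The d-cubes are the tuples of edges,
-- i.e. Φ(i_1,...,i_d), and t_k Φ(i) = s_k Φ(i + e_k).
data GCell : ∀ {d} → Vec ℕ d → ℕ → Set where
  []   : GCell [] 0
  vtx  : ∀ {d m n} {Ms : Vec ℕ d} → Fin (suc m) → GCell Ms n → GCell (m ∷ Ms) n
  edge : ∀ {d m n} {Ms : Vec ℕ d} → Fin m → GCell Ms n → GCell (m ∷ Ms) (suc n)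

endpoint : ∀ {m} → Side → Fin m → Fin (suc m)
endpoint false i = inject₁ i
endpoint true  i = suc i

gface : ∀ {d} {Ms : Vec ℕ d} {n} → Side → Fin (suc n) → GCell Ms (suc n) → GCell Ms n
gface α k       (vtx v x)  = vtx v (gface α k x)
gface α zero    (edge i x) = vtx (endpoint α i) x
gface {n = suc n} α (suc k) (edge i x) = edge i (gface α k x)

gface-cubical : ∀ {d} {Ms : Vec ℕ d} {n} (α β : Side) (k l : Fin (suc n)) → toℕ k ≤ toℕ l →
                (x : GCell Ms (suc (suc n))) →
                gface α k (gface β (suc l) x) ≡ gface β l (gface α (inject₁ k) x)
gface-cubical α β k l k≤l (vtx v x) rewrite gface-cubical α β k l k≤l x = _≡_.refl
gface-cubical α β zero l k≤l (edge i x) = _≡_.refl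
gface-cubical {n = suc n} α β (suc k) (suc l) (Data.Nat.s≤s k≤l) (edge i x)
  rewrite gface-cubical α β k l k≤l x = _≡_.refl

Grid : ∀ {d} → Vec ℕ d → PreCubical
Grid Ms = record { Cell = GCell Ms ; face = gface ; cubical = gface-cubical }

IsGrid : PreCubical → Set
IsGrid X = ∃[ d ] Σ (Vec ℕ d) λ Ms → All (1 ≤_) Ms × (X ≅ Grid Ms)

-- The bulk B^d is itself the grid [0,1]^d, so a sculpted precubical set embeds into a grid.
-- Conversely the grid [0,M_1] × ... × [0,M_d] embeds into the bulk B^(M_1 + ... + M_d): encode
-- each coordinate in unary, the vertex v of [0,M] as 1^v 0^(M-v) and the edge from v to v+1 as
-- 1^v ∗ 0^(M-v-1), and concatenate the codes.  Taking the source/target of the ∗ of an edge code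
-- gives the codes of its endpoints, so the encoding commutes with the face maps.
module Submission where

open import Defs
open import Data.Nat using (ℕ; zero; suc; _+_; s≤s; z≤n)
open import Data.Fin using (Fin; zero; suc)
open import Data.Bool using (true; false)
open import Data.Vec using (Vec; []; _∷_; replicate; sum)
open import Data.Vec.Relation.Unary.All using (All; []; _∷_)
open import Data.Product using (Σ; ∃-syntax; _×_; _,_)
open import Data.Empty using (⊥-elim)
open import Function.Bundles using (_⇔_; mk⇔)
open import Relation.Binary.PropositionalEquality
  using (_≡_; _≢_; refl; cong; sym; trans; module ≡-Reasoning)

private
  variable
    X Y Z : PreCubical

_∘ᴹ_ : Morphism Y Z → Morphism X Y → Morphism X Z
g ∘ᴹ f = record
  { map     = λ n x → map g n (map f n x)
  ; commute = λ α k x → trans (cong (map g _) (commute f α k x)) (commute g α k (map f _ x))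
  }

↪-trans : X ↪ Y → Y ↪ Z → X ↪ Z
↪-trans (f , f-inj) (g , g-inj) = g ∘ᴹ f , λ n eq → f-inj n (g-inj n eq)

≅⇒↪ : X ≅ Y → X ↪ Y
≅⇒↪ (f , g , g∘f≡id , _) = f , f-inj
  where
  open ≡-Reasoning
  f-inj : IsInjective f
  f-inj n {x} {y} fx≡fy = begin
    x                   ≡⟨ sym (g∘f≡id n x) ⟩
    map g n (map f n x) ≡⟨ cong (map g n) fx≡fy ⟩
    map g n (map f n y) ≡⟨ g∘f≡id n y ⟩
    y                   ∎

toGrid : ∀ {d n} → BCell d n → GCell (replicate d 1) n
toGrid []     = []
toGrid (c0 x) = vtx zero (toGrid x)
toGrid (c1 x) = vtx (suc zero) (toGrid x)
toGrid (c* x) = edge zero (toGrid x)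

fromGrid : ∀ {d n} → GCell (replicate d 1) n → BCell d n
fromGrid {zero}  []                = []
fromGrid {suc d} (vtx zero x)       = c0 (fromGrid x)
fromGrid {suc d} (vtx (suc zero) x) = c1 (fromGrid x)
fromGrid {suc d} (edge zero x)      = c* (fromGrid x)

toGrid-face : ∀ {d n} α (k : Fin (suc n)) (x : BCell d (suc n)) →
              toGrid (bface α k x) ≡ gface α k (toGrid x)
toGrid-face α     k       (c0 x) = cong (vtx zero) (toGrid-face α k x)
toGrid-face α     k       (c1 x) = cong (vtx (suc zero)) (toGrid-face α k x)
toGrid-face false zero    (c* x) = refl
toGrid-face true  zero    (c* x) = refl
toGrid-face {n = suc n} α (suc k) (c* x) = cong (edge zero) (toGrid-face α k x)

fromGrid-face : ∀ {d n} α (k : Fin (suc n)) (x : GCell (replicate d 1) (suc n)) →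
                fromGrid (gface α k x) ≡ bface α k (fromGrid x)
fromGrid-face {suc d} α     k    (vtx zero x)       = cong c0 (fromGrid-face α k x)
fromGrid-face {suc d} α     k    (vtx (suc zero) x) = cong c1 (fromGrid-face α k x)
fromGrid-face {suc d} false zero (edge zero x)      = refl
fromGrid-face {suc d} true  zero (edge zero x)      = refl
fromGrid-face {suc d} {suc n} α (suc k) (edge zero x) = cong c* (fromGrid-face α k x)

fromGrid∘toGrid : ∀ {d n} (x : BCell d n) → fromGrid (toGrid x) ≡ x
fromGrid∘toGrid []     = refl
fromGrid∘toGrid (c0 x) = cong c0 (fromGrid∘toGrid x)
fromGrid∘toGrid (c1 x) = cong c1 (fromGrid∘toGrid x)
fromGrid∘toGrid (c* x) = cong c* (fromGrid∘toGrid x)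

toGrid∘fromGrid : ∀ {d n} (x : GCell (replicate d 1) n) → toGrid (fromGrid x) ≡ x
toGrid∘fromGrid {zero}  []                = refl
toGrid∘fromGrid {suc d} (vtx zero x)       = cong (vtx zero) (toGrid∘fromGrid x)
toGrid∘fromGrid {suc d} (vtx (suc zero) x) = cong (vtx (suc zero)) (toGrid∘fromGrid x)
toGrid∘fromGrid {suc d} (edge zero x)      = cong (edge zero) (toGrid∘fromGrid x)

Bulk≅Grid : ∀ d → Bulk d ≅ Grid (replicate d 1)
Bulk≅Grid d =
  record { map = λ _ → toGrid ; commute = toGrid-face } ,
  record { map = λ _ → fromGrid ; commute = fromGrid-face } ,
  (λ _ → fromGrid∘toGrid) , (λ _ → toGrid∘fromGrid)

all-replicate : ∀ {A : Set} {P : A → Set} {x} d → P x → All P (replicate d x)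
all-replicate zero    px = []
all-replicate (suc d) px = px ∷ all-replicate d px

Bulk-isGrid : ∀ d → IsGrid (Bulk d)
Bulk-isGrid d = d , replicate d 1 , all-replicate d (s≤s z≤n) , Bulk≅Grid d

_++ᴮ_ : ∀ {a b p n} → BCell a p → BCell b n → BCell (a + b) (p + n)
[]   ++ᴮ y = y
c0 x ++ᴮ y = c0 (x ++ᴮ y)
c1 x ++ᴮ y = c1 (x ++ᴮ y)
c* x ++ᴮ y = c* (x ++ᴮ y)

unaryVertex : ∀ m → Fin (suc m) → BCell m 0
unaryVertex zero    zero    = []
unaryVertex (suc m) zero    = c0 (unaryVertex m zero)
unaryVertex (suc m) (suc v) = c1 (unaryVertex m v)

unaryEdge : ∀ m → Fin m → BCell m 1
unaryEdge (suc m) zero    = c* (unaryVertex m zero)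
unaryEdge (suc m) (suc i) = c1 (unaryEdge m i)

bface-unaryEdge : ∀ α m (i : Fin m) → bface α zero (unaryEdge m i) ≡ unaryVertex m (endpoint α i)
bface-unaryEdge false (suc m) zero    = refl
bface-unaryEdge true  (suc m) zero    = refl
bface-unaryEdge false (suc m) (suc i) = cong c1 (bface-unaryEdge false m i)
bface-unaryEdge true  (suc m) (suc i) = cong c1 (bface-unaryEdge true m i)

bface-++₀ : ∀ {a b n} α (k : Fin (suc n)) (v : BCell a 0) (y : BCell b (suc n)) →
            bface α k (v ++ᴮ y) ≡ v ++ᴮ bface α k y
bface-++₀ α k []     y = refl
bface-++₀ α k (c0 v) y = cong c0 (bface-++₀ α k v y)
bface-++₀ α k (c1 v) y = cong c1 (bface-++₀ α k v y)

bface-zero-++₁ : ∀ {a b n} α (e : BCell a 1) (y : BCell b n) →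
                 bface α zero (e ++ᴮ y) ≡ bface α zero e ++ᴮ y
bface-zero-++₁ α     (c0 e) y = cong c0 (bface-zero-++₁ α e y)
bface-zero-++₁ α     (c1 e) y = cong c1 (bface-zero-++₁ α e y)
bface-zero-++₁ false (c* e) y = refl
bface-zero-++₁ true  (c* e) y = refl

bface-suc-++₁ : ∀ {a b n} α (k : Fin (suc n)) (e : BCell a 1) (y : BCell b (suc n)) →
                bface α (suc k) (e ++ᴮ y) ≡ e ++ᴮ bface α k y
bface-suc-++₁ α k (c0 e) y = cong c0 (bface-suc-++₁ α k e y)
bface-suc-++₁ α k (c1 e) y = cong c1 (bface-suc-++₁ α k e y)
bface-suc-++₁ α k (c* e) y = cong c* (bface-++₀ α k e y)

c0-injective : ∀ {d n} {x y : BCell d n} → c0 x ≡ c0 y → x ≡ y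
c0-injective refl = refl

c1-injective : ∀ {d n} {x y : BCell d n} → c1 x ≡ c1 y → x ≡ y
c1-injective refl = refl

c*-injective : ∀ {d n} {x y : BCell d n} → c* x ≡ c* y → x ≡ y
c*-injective refl = refl

++ᴮ-injective : ∀ {a b p n} (x x′ : BCell a p) {y y′ : BCell b n} →
                x ++ᴮ y ≡ x′ ++ᴮ y′ → x ≡ x′ × y ≡ y′
++ᴮ-injective []     []      eq = refl , eq
++ᴮ-injective (c0 x) (c0 x′) eq with ++ᴮ-injective x x′ (c0-injective eq)
... | refl , y≡y′ = refl , y≡y′
++ᴮ-injective (c1 x) (c1 x′) eq with ++ᴮ-injective x x′ (c1-injective eq)
... | refl , y≡y′ = refl , y≡y′
++ᴮ-injective (c* x) (c* x′) eq with ++ᴮ-injective x x′ (c*-injective eq)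
... | refl , y≡y′ = refl , y≡y′
++ᴮ-injective (c0 x) (c1 x′) ()
++ᴮ-injective (c1 x) (c0 x′) ()

unaryVertex-++≢unaryEdge-++ : ∀ {m b n} (v : Fin (suc m)) (i : Fin m)
                              {y : BCell b (suc n)} {y′ : BCell b n} →
                              unaryVertex m v ++ᴮ y ≢ unaryEdge m i ++ᴮ y′
unaryVertex-++≢unaryEdge-++ {suc m} zero    zero    ()
unaryVertex-++≢unaryEdge-++ {suc m} zero    (suc i) ()
unaryVertex-++≢unaryEdge-++ {suc m} (suc v) zero    ()
unaryVertex-++≢unaryEdge-++ {suc m} (suc v) (suc i) eq =
  unaryVertex-++≢unaryEdge-++ v i (c1-injective eq)

unaryVertex-injective : ∀ m {v w : Fin (suc m)} → unaryVertex m v ≡ unaryVertex m w → v ≡ w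
unaryVertex-injective zero    {zero}  {zero}  eq = refl
unaryVertex-injective (suc m) {zero}  {zero}  eq = refl
unaryVertex-injective (suc m) {suc v} {suc w} eq = cong suc (unaryVertex-injective m (c1-injective eq))

unaryEdge-injective : ∀ m {i j : Fin m} → unaryEdge m i ≡ unaryEdge m j → i ≡ j
unaryEdge-injective (suc m) {zero}  {zero}  eq = refl
unaryEdge-injective (suc m) {suc i} {suc j} eq = cong suc (unaryEdge-injective m (c1-injective eq))

unaryCode : ∀ {d} {Ms : Vec ℕ d} {n} → GCell Ms n → BCell (sum Ms) n
unaryCode []                 = []
unaryCode (vtx {m = m} v x)  = unaryVertex m v ++ᴮ unaryCode x
unaryCode (edge {m = m} i x) = unaryEdge m i ++ᴮ unaryCode x

unaryCode-face : ∀ {d} {Ms : Vec ℕ d} {n} α (k : Fin (suc n)) (x : GCell Ms (suc n)) →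
                 unaryCode (gface α k x) ≡ bface α k (unaryCode x)
unaryCode-face α k (vtx {m = m} v x) = begin
  unaryVertex m v ++ᴮ unaryCode (gface α k x) ≡⟨ cong (unaryVertex m v ++ᴮ_) (unaryCode-face α k x) ⟩
  unaryVertex m v ++ᴮ bface α k (unaryCode x) ≡⟨ sym (bface-++₀ α k (unaryVertex m v) (unaryCode x)) ⟩
  bface α k (unaryVertex m v ++ᴮ unaryCode x) ∎
  where open ≡-Reasoning
unaryCode-face α zero (edge {m = m} i x) = begin
  unaryVertex m (endpoint α i) ++ᴮ unaryCode x  ≡⟨ cong (_++ᴮ unaryCode x) (sym (bface-unaryEdge α m i)) ⟩
  bface α zero (unaryEdge m i) ++ᴮ unaryCode x  ≡⟨ sym (bface-zero-++₁ α (unaryEdge m i) (unaryCode x)) ⟩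
  bface α zero (unaryEdge m i ++ᴮ unaryCode x)  ∎
  where open ≡-Reasoning
unaryCode-face {n = suc n} α (suc k) (edge {m = m} i x) = begin
  unaryEdge m i ++ᴮ unaryCode (gface α k x)     ≡⟨ cong (unaryEdge m i ++ᴮ_) (unaryCode-face α k x) ⟩
  unaryEdge m i ++ᴮ bface α k (unaryCode x)     ≡⟨ sym (bface-suc-++₁ α k (unaryEdge m i) (unaryCode x)) ⟩
  bface α (suc k) (unaryEdge m i ++ᴮ unaryCode x) ∎
  where open ≡-Reasoning

unaryCode-injective : ∀ {d} {Ms : Vec ℕ d} {n} (x y : GCell Ms n) →
                      unaryCode x ≡ unaryCode y → x ≡ y
unaryCode-injective [] [] eq = refl
unaryCode-injective (vtx {m = m} v x) (vtx w y) eq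
  with ++ᴮ-injective (unaryVertex m v) (unaryVertex m w) eq
... | codes≡ , rest≡
  rewrite unaryVertex-injective m codes≡ | unaryCode-injective x y rest≡ = refl
unaryCode-injective (edge {m = m} i x) (edge j y) eq
  with ++ᴮ-injective (unaryEdge m i) (unaryEdge m j) eq
... | codes≡ , rest≡
  rewrite unaryEdge-injective m codes≡ | unaryCode-injective x y rest≡ = refl
unaryCode-injective (vtx v x) (edge i y) eq = ⊥-elim (unaryVertex-++≢unaryEdge-++ v i eq)
unaryCode-injective (edge i x) (vtx v y) eq = ⊥-elim (unaryVertex-++≢unaryEdge-++ v i (sym eq))

Grid↪Bulk : ∀ {d} (Ms : Vec ℕ d) → Grid Ms ↪ Bulk (sum Ms)
Grid↪Bulk Ms = record { map = λ _ → unaryCode ; commute = unaryCode-face } ,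
               λ _ → unaryCode-injective _ _

lemma5p4 : (X : PreCubical) →
    (Σ PreCubical (λ G → IsGrid G × (X ↪ G))) ⇔ (∃[ d ] (X ↪ Bulk d))
lemma5p4 X = mk⇔ sculpt embedIntoGrid
  where
  sculpt : Σ PreCubical (λ G → IsGrid G × (X ↪ G)) → ∃[ d ] (X ↪ Bulk d)
  sculpt (G , (_ , Ms , _ , G≅Grid) , X↪G) =
    sum Ms , ↪-trans X↪G (↪-trans (≅⇒↪ G≅Grid) (Grid↪Bulk Ms))

  embedIntoGrid : ∃[ d ] (X ↪ Bulk d) → Σ PreCubical (λ G → IsGrid G × (X ↪ G))
  embedIntoGrid (d , X↪Bulk) = Bulk d , Bulk-isGrid d , X↪Bulk
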